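{- Work in the semantics described in the context, in modal logic $\mathbf{K}$. Suppose the following formulas are globally valid in a model: (A1') $\boldsymbol{\neg}\,\mathcal{P}(\lambda x.\, x \boldsymbol{\neq} x)$; (A2') $\boldsymbol{\forall} X\, Y.\ \big((\mathcal{P}\,X \boldsymbol{\wedge} (X \boldsymbol{\sqsubseteq} Y \boldsymbol{\vee} X \boldsymbol{\Rrightarrow} Y)) \boldsymbol{\rightarrow} \mathcal{P}\,Y\big)$; (T2) $\mathcal{P}\,\mathcal{G}$. Then in that model $\boldsymbol{\Box}(\boldsymbol{\exists}^E \mathcal{G})$ is globally valid. Moreover, modal collapse is not entailed by these axioms: there is a model in which A1', A2' and T2 are globally valid but $\boldsymbol\forall \Phi.\,(\Phi \boldsymbol\rightarrow \boldsymbol\Box \Phi)$ (with $\Phi$ ranging over propositions) is not globally valid.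
   Context: Semantics (higher-order modal logic, possible-world semantics). A model consists of: a nonempty set $W$ of worlds; an arbitrary binary accessibility relation $r$ on $W$; a nonempty set $D$ of individuals; a relation $\mathrm{existsAt} \subseteq D\times W$ (which may be empty at some worlds); and an interpretation of a constant $\mathcal{P}$. A proposition is a function $W\to\{\mathrm{true},\mathrm{false}\}$. A property is any function $D \to (W\to\{\mathrm{true},\mathrm{false}\})$, and $\mathcal{P}$ maps properties to propositions. Connectives are world-lifted and evaluated pointwise. $(\boldsymbol\Box\varphi)(w)$ iff $\varphi(v)$ for all $v$ with $r(w,v)$. Possibilist quantifiers $\boldsymbol\forall,\boldsymbol\exists$ range over all objects of the relevant type (individuals, properties, propositions). Actualist quantifiers over individuals: $(\boldsymbol\forall^E x.\,\Phi x)(w)$ iff $\Phi(a)(w)$ for all $a\in D$ with $\mathrm{existsAt}(a,w)$, and $\boldsymbol\exists^E$ is defined dually. $\boldsymbol\exists^E Y$ abbreviates $\boldsymbol\exists^E x.\,Y x$. Equality of individuals is world-independent identity, and $\boldsymbol\neq$ is its negation. A formula is globally valid iff it holds at every world. Definitions: $X \boldsymbol{\sqsubseteq} Y \equiv \boldsymbol\forall^E z.\,(X z \boldsymbol\rightarrow Y z)$; $X \boldsymbol{\Rrightarrow} Y \equiv \boldsymbol\Box(X \boldsymbol{\sqsubseteq} Y)$; Godlike: $\mathcal{G}\,x \equiv \boldsymbol\forall Y.\,(\mathcal{P}\,Y \boldsymbol\rightarrow Y x)$. -}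

module Defs where

open import Data.Bool using (Bool; true; false)
open import Data.Product using (_×_; Σ; _,_)
open import Data.Empty using (⊥)
open import Relation.Nullary using (¬_)
open import Relation.Binary.PropositionalEquality using (_≡_)

record Model : Set₁ where
  field
    W        : Set
    w₀       : W
    r        : W → W → Set
    D        : Set
    d₀       : D
    existsAt : D → W → Set       -- may be empty at some worlds
    𝒫        : (D → W → Bool) → W → Bool

module _ (M : Model) where
  open Model M

  Prop : Set
  Prop = W → Bool

  Property : Set
  Property = D → W → Bool

  -- Meta-level "truth at a world" of (world-lifted) formulas.
  Form : Set₁
  Form = W → Set

  ⟦_⟧ : Prop → Form
  ⟦ φ ⟧ w = φ w ≡ true

  Valid : Form → Set
  Valid φ = ∀ w → φ w

  -- classical connectives (stable / double-negation reading of ∨ and ∃)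
  ¬ₘ_ : Form → Form
  (¬ₘ φ) w = ¬ φ w

  _∧ₘ_ : Form → Form → Form
  (φ ∧ₘ ψ) w = φ w × ψ w

  _∨ₘ_ : Form → Form → Form
  (φ ∨ₘ ψ) w = ¬ (¬ φ w × ¬ ψ w)

  _⇒ₘ_ : Form → Form → Form
  (φ ⇒ₘ ψ) w = φ w → ψ w

  □ : Form → Form
  □ φ w = ∀ v → r w v → φ v

  ∀ᴱ : (D → Form) → Form
  ∀ᴱ Φ w = ∀ a → existsAt a w → Φ a w

  ∃ᴱ : (D → Form) → Form
  ∃ᴱ Φ w = ¬ (∀ a → existsAt a w → ¬ Φ a w)

  ∃ᴱ[_] : Property → Form
  ∃ᴱ[ Y ] = ∃ᴱ (λ x → ⟦ Y x ⟧)

  _⊑_ : Property → Property → Form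
  X ⊑ Y = ∀ᴱ (λ z → ⟦ X z ⟧ ⇒ₘ ⟦ Y z ⟧)

  _⇛_ : Property → Property → Form
  X ⇛ Y = □ (X ⊑ Y)

  GodlikeF : D → Form
  GodlikeF x w = ∀ (Y : Property) → 𝒫 Y w ≡ true → Y x w ≡ true

  -- g is the property 𝒢 (the characteristic function of GodlikeF)
  IsGodlike : Property → Set
  IsGodlike g = ∀ x w → (g x w ≡ true → GodlikeF x w) × (GodlikeF x w → g x w ≡ true)

  -- the property λx. x ≠ x : identity is world-independent, so x ≠ x is false everywhere
  nonSelfIdentical : Property
  nonSelfIdentical x w = false

  A1' : Set
  A1' = Valid (¬ₘ ⟦ 𝒫 nonSelfIdentical ⟧)

  A2' : Set
  A2' = Valid (λ w → ∀ (X Y : Property) →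
          ((⟦ 𝒫 X ⟧ ∧ₘ ((X ⊑ Y) ∨ₘ (X ⇛ Y))) ⇒ₘ ⟦ 𝒫 Y ⟧) w)

  T2 : Property → Set
  T2 g = Valid ⟦ 𝒫 g ⟧

  ModalCollapse : Form
  ModalCollapse w = ∀ (Φ : Prop) → (⟦ Φ ⟧ ⇒ₘ □ ⟦ Φ ⟧) w

module Submission where

-- The key observation is that A1' and A2' already force
-- every positive property to be exemplified by an actual individual: if no
-- existing individual has Y at a world w, then Y ⊑ X holds vacuously at w for
-- every X, in particular for the empty property λx. x ≠ x; so 𝒫 Y together with
-- A2' yields 𝒫 (λx. x ≠ x), contradicting A1'.  Since T2 makes 𝒢 positive at
-- every world, 𝒢 is exemplified at every world, hence □ ∃ᴱ 𝒢 holds everywhere.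
--
-- A countermodel has two worlds (the booleans), universal
-- accessibility, a single individual existing everywhere, and positivity of Y
-- at w meaning that the individual has Y at w.  Every individual is then
-- godlike, A1', A2' and T2 hold, yet the proposition true only at the world
-- `true` is not necessary there, so modal collapse fails at `true`.

open import Defs
open import Data.Product using (_×_; Σ; _,_)
open import Relation.Nullary using (¬_)
open import Relation.Nullary.Decidable using (decidable-stable)
open import Data.Bool using (Bool; true; false)
open import Data.Bool.Properties using (_≟_)
open import Data.Unit using (⊤; tt)
open import Data.Empty using (⊥-elim)
open import Relation.Binary.PropositionalEquality using (_≡_; refl)

module _ (M : Model) where
  open Model M

  uninstantiated⊑ : ∀ (Y X : Property M) w →
    (∀ a → existsAt a w → ¬ Y a w ≡ true) → (_⊑_ M Y X) w
  uninstantiated⊑ Y X w noInstance a e Ya = ⊥-elim (noInstance a e Ya)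

  positive⇒instantiated : A1' M → A2' M →
    ∀ (Y : Property M) w → ⟦_⟧ M (𝒫 Y) w → ∃ᴱ[_] M Y w
  positive⇒instantiated a1 a2 Y w PY noInstance =
    a1 w (a2 w Y (nonSelfIdentical M)
            (PY , λ (notIncluded , _) →
                    notIncluded (uninstantiated⊑ Y (nonSelfIdentical M) w noInstance)))

necessaryExistence : (M : Model) → (g : Property M) →
  IsGodlike M g → A1' M → A2' M → T2 M g → Valid M (□ M (∃ᴱ[_] M g))
necessaryExistence M g _ a1 a2 t2 _ v _ = positive⇒instantiated M a1 a2 g v (t2 v)

collapseCountermodel : Model
collapseCountermodel = record
  { W = Bool ; w₀ = true ; r = λ _ _ → ⊤ ; D = ⊤ ; d₀ = tt
  ; existsAt = λ _ _ → ⊤ ; 𝒫 = λ Y w → Y tt w }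

module Countermodel where
  private
    M₀ : Model
    M₀ = collapseCountermodel

  -- Every individual has every property: the constantly true property is 𝒢.
  godlike : Property M₀
  godlike _ _ = true

  godlike-isGodlike : IsGodlike M₀ godlike
  godlike-isGodlike x w = (λ _ Y PY → PY) , (λ _ → refl)

  a1 : A1' M₀
  a1 w ()

  -- Both disjuncts of A2' carry positivity of X to Y: the ⊑-disjunct by
  -- instantiating it at the individual, the ⇛-disjunct by reflexivity of r.
  a2 : A2' M₀
  a2 w X Y (PX , included∨entailed) =
    decidable-stable (Y tt w ≟ true) λ ¬PY →
      included∨entailed ( (λ included → ¬PY (included tt tt PX))
                        , (λ entailed → ¬PY (entailed w tt tt tt PX)) )

  t2 : T2 M₀ godlike
  t2 w = refl

  -- The proposition "the actual world is `true`" holds at `true` but not at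
  -- the accessible world `false`.
  noCollapse : ¬ Valid M₀ (ModalCollapse M₀)
  noCollapse collapse with collapse true (λ w → w) refl false tt
  ... | ()

mainTheorem3 :
    ((M : Model) → (g : Property M) →
      IsGodlike M g → A1' M → A2' M → T2 M g →
      Valid M (□ M (∃ᴱ[_] M g)))
  × Σ Model (λ M → Σ (Property M) (λ g →
      IsGodlike M g × A1' M × A2' M × T2 M g × ¬ Valid M (ModalCollapse M)))
mainTheorem3 =
  necessaryExistence ,
  (collapseCountermodel , godlike , godlike-isGodlike , a1 , a2 , t2 , noCollapse)
  where open Countermodel
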